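{- Let $(F_n)_{n\ge 0}$ be the Fibonacci sequence, $F_0=0$, $F_1=1$, $F_n=F_{n-1}+F_{n-2}$ for $n\ge 2$. Fix a positive integer $N$. Consider a walk $a_1,a_2,\dots$ of positive Fibonacci numbers such that for each pair of consecutive terms there are integers $n_i$ and $d_i$ with $1\le n_i\le N$, $0\le d_i\le 10^{n_i}-1$ and $a_{i+1}=10^{n_i}a_i+d_i$ (i.e., each term is obtained from the previous by appending at most $N$ decimal digits to the right, leading zeros in the appended block allowed). Suppose the starting number $a_1$ has $N_0$ decimal digits. If $N_0\ge 2$, then the length of the walk (number of terms, including $a_1$) is at most $\left\lfloor \log_2\frac{N}{N_0-1}\right\rfloor+2$. If $N_0=1$, the length of the walk is at most $\lfloor \log_2 N\rfloor+2$.
   Context: Appending $n$ digits to a positive integer $a$ means forming $10^n a+d$ with $0\le d\le 10^n-1$; the appended block may have leading zeros. -}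

module Defs where

open import Data.Nat using (ℕ; zero; suc; _+_; _*_; _∸_; _^_; _≤_; _<_; _≤ᵇ_)
open import Data.Nat.DivMod using (_/_)
open import Data.Nat.Logarithm using (⌊log₂_⌋; ⌈log₂_⌉)
open import Data.Integer using (ℤ; +_; -_)
open import Data.Bool using (if_then_else_)
open import Data.Product using (Σ; ∃; _×_)
open import Data.List using (List)
open import Relation.Binary.PropositionalEquality using (_≡_)
open import Data.List.Relation.Unary.All using (All)
open import Data.List.Relation.Unary.Linked using (Linked)

fib : ℕ → ℕ
fib zero = zero
fib (suc zero) = suc zero
fib (suc (suc n)) = fib (suc n) + fib n

PosFib : ℕ → Set
PosFib a = (0 < a) × ∃ λ n → fib n ≡ a

AppendStep : ℕ → ℕ → ℕ → Set
AppendStep N a b =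
  Σ ℕ λ n → Σ ℕ λ d → (1 ≤ n) × (n ≤ N) × (d < 10 ^ n) × (b ≡ 10 ^ n * a + d)

FibWalk : ℕ → List ℕ → Set
FibWalk N as = All PosFib as × Linked (AppendStep N) as

-- ⌊log₂ (p / q)⌋ ∈ ℤ for positive naturals p, q (rational argument p/q).
-- If q ≤ p:  ⌊log₂ (p/q)⌋ = ⌊log₂ ⌊p/q⌋⌋.
-- If p < q:  ⌊log₂ (p/q)⌋ = - ⌈log₂ (q/p)⌉ = - ⌈log₂ ⌈q/p⌉⌉,
--            with ⌈q/p⌉ = (q + p ∸ 1) / p.
-- (Values for p = 0 or q = 0 are junk and never used.)
floorLog2Frac : ℕ → ℕ → ℤ
floorLog2Frac zero q = + 0
floorLog2Frac (suc p) zero = + 0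
floorLog2Frac (suc p) (suc q) =
  if suc q ≤ᵇ suc p
  then + ⌊log₂ (suc p / suc q) ⌋
  else - (+ ⌈log₂ ((suc q + p) / suc p) ⌉)

-- If appending n digits to a Fibonacci number F_k gives a Fibonacci number
-- F_m = 10^n F_k + d, then F_k < 3·10^n.  Write m = k + p + 1.  If p ≥ k, then
-- F_m ≥ F_k F_(p+2) forces F_k < 10^n.  Otherwise k = p + 1 + i and
-- L_(p+1) F_k = F_m ± F_i compares the Lucas number L_(p+1) with 10^n; they
-- differ because no Lucas number is divisible by 5, and comparing them gives
-- F_(k-2) < 10^n, hence F_k ≤ 3 F_(k-2) < 3·10^n.  So a term with more than e
-- digits forces the next appended block to have at least e digits: the number
-- of digits beyond the first at least doubles at each step, while each block
-- has at most N digits.  From a one-digit start the doubling begins with the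
-- second term, which has at least three digits unless it is 13, 21, 34, 55 or
-- 89; none of these extends by one or two digits, so then the third term has
-- at least five.
module Submission where

open import Defs
open import Data.Nat
open import Data.Nat.Properties
open import Data.Nat.DivMod using (_/_; _%_; %-distribˡ-+; m*n%n≡0; m*n/n≡m; /-monoˡ-≤)
open import Data.Nat.Logarithm using (⌊log₂_⌋; ⌊log₂⌋-mono-≤; ⌊log₂[2^n]⌋≡n)
open import Data.Integer using (+_; +≤+) renaming (_+_ to _+ℤ_; _≤_ to _≤ℤ_)
open import Data.Integer.Properties using () renaming (+-monoˡ-≤ to +ℤ-monoˡ-≤)
open import Data.Nat.Solver using (module +-*-Solver)
open import Data.Product using (_×_; _,_; proj₁; proj₂)
open import Data.Sum using (_⊎_; inj₁; inj₂)
open import Data.Empty using (⊥; ⊥-elim)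
open import Data.Bool using (T; true)
open import Data.Unit using (tt)
open import Relation.Nullary using (contradiction; yes; no)
open import Relation.Binary using (tri<; tri≈; tri>)
open import Data.List using (List; []; _∷_; length)
open import Data.List.Relation.Unary.All using ([]; _∷_)
open import Data.List.Relation.Unary.Linked using ([-]; _∷_)
open import Relation.Binary.PropositionalEquality
open import Function using (_∘_)
open +-*-Solver using (solve; _:+_; _:*_; _:=_; con)

fib-add : ∀ a b → fib (suc (a + b)) ≡ fib (suc a) * fib (suc b) + fib a * fib b
fib-add zero b = solve 2 (λ x y → x := con 1 :* x :+ con 0 :* y) refl (fib (suc b)) (fib b)
fib-add (suc a) b = begin
  fib (2 + (a + b))                                          ≡⟨ cong (fib ∘ suc) (+-suc a b) ⟨
  fib (suc (a + suc b))                                      ≡⟨ fib-add a (suc b) ⟩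
  fib (suc a) * (fib (suc b) + fib b) + fib a * fib (suc b)
    ≡⟨ solve 4 (λ x y u v → x :* (u :+ v) :+ y :* u := (x :+ y) :* u :+ x :* v) refl
         (fib (suc a)) (fib a) (fib (suc b)) (fib b) ⟩
  (fib (suc a) + fib a) * fib (suc b) + fib (suc a) * fib b  ∎
  where open ≡-Reasoning

fib-≤-suc : ∀ n → fib n ≤ fib (suc n)
fib-≤-suc zero    = z≤n
fib-≤-suc (suc n) = m≤m+n (fib (suc n)) (fib n)

fib-mono-≤ : ∀ {m n} → m ≤ n → fib m ≤ fib n
fib-mono-≤ = go ∘ ≤⇒≤′
  where
  go : ∀ {m n} → m ≤′ n → fib m ≤ fib n
  go ≤′-refl        = ≤-refl
  go {n = suc n} (≤′-step m≤′n) = ≤-trans (go m≤′n) (fib-≤-suc n)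

fib-suc-pos : ∀ n → 0 < fib (suc n)
fib-suc-pos n = fib-mono-≤ {1} {suc n} (s≤s z≤n)

-- |x − y| = e, kept in ℕ by naming the direction of the difference.
infix 4 _≡_±_

_≡_±_ : ℕ → ℕ → ℕ → Set
x ≡ y ± e = x ≡ y + e ⊎ x + e ≡ y

±-sym : ∀ {x y e} → x ≡ y ± e → y ≡ x ± e
±-sym (inj₁ x≡y+e) = inj₂ (sym x≡y+e)
±-sym (inj₂ x+e≡y) = inj₁ (sym x+e≡y)

±-+ˡ : ∀ z {x y e} → x ≡ y ± e → z + x ≡ z + y ± e
±-+ˡ z (inj₁ x≡y+e) = inj₁ (trans (cong (_+_ z) x≡y+e) (sym (+-assoc z _ _)))
±-+ˡ z (inj₂ x+e≡y) = inj₂ (trans (+-assoc z _ _) (cong (_+_ z) x+e≡y))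

fib-dOcagne : ∀ p i → fib (suc p + i) * fib (2 + p) ≡ fib (2 + p + i) * fib (suc p) ± fib i
fib-dOcagne zero i = inj₂ (solve 2 (λ x y → x :* con 1 :+ y := (x :+ y) :* con 1) refl
                                    (fib (suc i)) (fib i))
fib-dOcagne (suc p) i = subst₂ (_≡_± fib i)
  (sym (*-distribˡ-+ B X Y)) (sym (*-distribʳ-+ X B A))
  (±-+ˡ (B * X) (±-sym (fib-dOcagne p i)))
  where
  A = fib (suc p + i)
  B = fib (2 + p + i)
  X = fib (2 + p)
  Y = fib (suc p)

lucas : ℕ → ℕ
lucas zero             = 2
lucas (suc zero)       = 1
lucas (suc (suc n))    = lucas (suc n) + lucas n

lucas-suc : ∀ n → lucas (suc n) ≡ fib (2 + n) + fib n
lucas-suc zero          = refl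
lucas-suc (suc zero)    = refl
lucas-suc (suc (suc n)) = begin
  lucas (2 + n) + lucas (suc n)                          ≡⟨ cong₂ _+_ (lucas-suc (suc n)) (lucas-suc n) ⟩
  (fib (3 + n) + fib (suc n)) + (fib (2 + n) + fib n)
    ≡⟨ solve 2 (λ x y → (((x :+ y) :+ x) :+ x) :+ ((x :+ y) :+ y)
                     := (((x :+ y) :+ x) :+ (x :+ y)) :+ (x :+ y)) refl (fib (suc n)) (fib n) ⟩
  fib (4 + n) + fib (2 + n)                              ∎
  where open ≡-Reasoning

lucas-*-fib : ∀ p i → lucas (suc p) * fib (suc p + i) ≡ fib (suc (suc p + i + p)) ± fib i
lucas-*-fib p i = subst₂ (_≡_± fib i) (sym lhs) (sym (trans (fib-add k p) (+-comm (fib (suc k) * fib (suc p)) _)))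
  (±-+ˡ (fib k * fib p) (fib-dOcagne p i))
  where
  k = suc p + i
  lhs : lucas (suc p) * fib k ≡ fib k * fib p + fib k * fib (2 + p)
  lhs = begin
    lucas (suc p) * fib k            ≡⟨ cong (_* fib k) (lucas-suc p) ⟩
    (fib (2 + p) + fib p) * fib k    ≡⟨ solve 3 (λ x y z → (x :+ y) :* z := z :* y :+ z :* x) refl
                                          (fib (2 + p)) (fib p) (fib k) ⟩
    fib k * fib p + fib k * fib (2 + p) ∎
    where open ≡-Reasoning

data LucasResidues : ℕ → ℕ → Set where
  2,1 : LucasResidues 2 1
  1,3 : LucasResidues 1 3
  3,4 : LucasResidues 3 4
  4,2 : LucasResidues 4 2

lucasResidues-next : ∀ {r s} → LucasResidues r s → LucasResidues s ((s + r) % 5)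
lucasResidues-next 2,1 = 1,3
lucasResidues-next 1,3 = 3,4
lucasResidues-next 3,4 = 4,2
lucasResidues-next 4,2 = 2,1

lucasResidues-nonzero : ∀ {r s} → LucasResidues r s → r ≢ 0
lucasResidues-nonzero 2,1 ()
lucasResidues-nonzero 1,3 ()
lucasResidues-nonzero 3,4 ()
lucasResidues-nonzero 4,2 ()

lucas-residues : ∀ n → LucasResidues (lucas n % 5) (lucas (suc n) % 5)
lucas-residues zero    = 2,1
lucas-residues (suc n) = subst (LucasResidues (lucas (suc n) % 5))
  (sym (%-distribˡ-+ (lucas (suc n)) (lucas n) 5))
  (lucasResidues-next (lucas-residues n))

lucas≢10^ : ∀ {n} → 1 ≤ n → ∀ p → lucas p ≢ 10 ^ n
lucas≢10^ {suc n} _ p lucas≡10^ = lucasResidues-nonzero (lucas-residues p) (begin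
  lucas p % 5          ≡⟨ cong (_% 5) lucas≡10^ ⟩
  10 * 10 ^ n % 5      ≡⟨ cong (_% 5) (solve 1 (λ x → con 10 :* x := (con 2 :* x) :* con 5) refl (10 ^ n)) ⟩
  2 * 10 ^ n * 5 % 5   ≡⟨ m*n%n≡0 (2 * 10 ^ n) 5 ⟩
  0                    ∎)
  where open ≡-Reasoning

near-multiple-bound : ∀ {L c F d e} → L ≢ c → e < F → L * F ≡ c * F + d ± e → F ≤ d + e
near-multiple-bound {L} {c} {F} {d} {e} L≢c e<F near with <-cmp L c
... | tri≈ _ L≡c _ = contradiction L≡c L≢c
... | tri< L<c _ _ = ⊥-elim (below near)
  where
  open ≤-Reasoning
  F+LF≤cF+d : F + L * F ≤ c * F + d
  F+LF≤cF+d = ≤-trans (*-monoˡ-≤ F L<c) (m≤m+n (c * F) d)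
  below : L * F ≡ c * F + d ± e → ⊥
  below (inj₁ LF≡cF+d+e) = <⇒≱ (m<n+m (L * F) (≤-<-trans z≤n e<F)) (begin
    F + L * F       ≤⟨ F+LF≤cF+d ⟩
    c * F + d       ≤⟨ m≤m+n _ e ⟩
    c * F + d + e   ≡⟨ LF≡cF+d+e ⟨
    L * F           ∎)
  below (inj₂ LF+e≡cF+d) = <⇒≱ e<F (+-cancelʳ-≤ (L * F) F e (begin
    F + L * F       ≤⟨ F+LF≤cF+d ⟩
    c * F + d       ≡⟨ LF+e≡cF+d ⟨
    L * F + e       ≡⟨ +-comm (L * F) e ⟩
    e + L * F       ∎))
... | tri> _ _ c<L = +-cancelˡ-≤ (c * F) F (d + e) (above near)
  where
  open ≤-Reasoning
  cF+F≤LF : c * F + F ≤ L * F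
  cF+F≤LF = ≤-trans (≤-reflexive (+-comm (c * F) F)) (*-monoˡ-≤ F c<L)
  above : L * F ≡ c * F + d ± e → c * F + F ≤ c * F + (d + e)
  above (inj₁ LF≡cF+d+e) = begin
    c * F + F       ≤⟨ cF+F≤LF ⟩
    L * F           ≡⟨ LF≡cF+d+e ⟩
    c * F + d + e   ≡⟨ +-assoc (c * F) d e ⟩
    c * F + (d + e) ∎
  above (inj₂ LF+e≡cF+d) = begin
    c * F + F       ≤⟨ cF+F≤LF ⟩
    L * F           ≤⟨ m≤m+n (L * F) e ⟩
    L * F + e       ≡⟨ LF+e≡cF+d ⟩
    c * F + d       ≤⟨ +-monoʳ-≤ (c * F) (m≤m+n d e) ⟩
    c * F + (d + e) ∎

fib-*-≤ : ∀ k p → fib k * fib (2 + p) ≤ fib (suc (k + p))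
fib-*-≤ k p = begin
  fib k * (fib (suc p) + fib p)              ≡⟨ *-distribˡ-+ (fib k) (fib (suc p)) (fib p) ⟩
  fib k * fib (suc p) + fib k * fib p        ≤⟨ +-monoˡ-≤ _ (*-monoˡ-≤ (fib (suc p)) (fib-≤-suc k)) ⟩
  fib (suc k) * fib (suc p) + fib k * fib p  ≡⟨ fib-add k p ⟨
  fib (suc (k + p))                          ∎
  where open ≤-Reasoning

2*fib≤fib[2+n] : ∀ n → 2 * fib n ≤ fib (2 + n)
2*fib≤fib[2+n] n = begin
  2 * fib n               ≡⟨ cong (_+_ (fib n)) (+-identityʳ (fib n)) ⟩
  fib n + fib n           ≤⟨ +-monoˡ-≤ (fib n) (fib-≤-suc n) ⟩
  fib (suc n) + fib n     ∎
  where open ≤-Reasoning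

fib[3+n]≤3*fib[1+n] : ∀ n → fib (3 + n) ≤ 3 * fib (suc n)
fib[3+n]≤3*fib[1+n] n = begin
  (fib (suc n) + fib n) + fib (suc n)  ≤⟨ +-monoˡ-≤ (fib (suc n)) (+-monoʳ-≤ (fib (suc n)) (fib-≤-suc n)) ⟩
  (fib (suc n) + fib (suc n)) + fib (suc n)
    ≡⟨ solve 1 (λ x → (x :+ x) :+ x := con 3 :* x) refl (fib (suc n)) ⟩
  3 * fib (suc n)                      ∎
  where open ≤-Reasoning

fib-index-< : ∀ {c d k m} → 2 ≤ c → 0 < fib k → fib m ≡ c * fib k + d → k < m
fib-index-< {c} {d} {k} {m} 2≤c 0<F fib-m≡ = ≰⇒> λ m≤k → <⇒≱ F<fib-m (fib-mono-≤ m≤k)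
  where
  open ≤-Reasoning
  F<fib-m : fib k < fib m
  F<fib-m = begin-strict
    fib k              <⟨ m<m+n (fib k) 0<F ⟩
    fib k + fib k      ≡⟨ cong (_+_ (fib k)) (+-identityʳ (fib k)) ⟨
    2 * fib k          ≤⟨ *-monoˡ-≤ (fib k) 2≤c ⟩
    c * fib k          ≤⟨ m≤m+n (c * fib k) d ⟩
    c * fib k + d      ≡⟨ fib-m≡ ⟨
    fib m              ∎

appended-fib-bound-far : ∀ {c d k p} → 0 < fib k → k ≤ p → d < c →
  fib (suc (k + p)) ≡ c * fib k + d → fib k < c
appended-fib-bound-far {c} {d} {k} {p} 0<F k≤p d<c fib≡ = *-cancelˡ-< 2 (fib k) c (begin-strict
  2 * fib k     ≤⟨ 2*fib≤fib[2+n] k ⟩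
  fib (2 + k)   ≤⟨ fib-mono-≤ (s≤s (s≤s k≤p)) ⟩
  fib (2 + p)   <⟨ *-cancelˡ-< (fib k) (fib (2 + p)) (2 * c) F*fib[2+p]<F*2c ⟩
  2 * c         ∎)
  where
  open ≤-Reasoning
  F*fib[2+p]<F*2c : fib k * fib (2 + p) < fib k * (2 * c)
  F*fib[2+p]<F*2c = begin-strict
    fib k * fib (2 + p)        ≤⟨ fib-*-≤ k p ⟩
    fib (suc (k + p))          ≡⟨ fib≡ ⟩
    c * fib k + d              <⟨ +-monoʳ-< (c * fib k) (<-≤-trans d<c c≤cF) ⟩
    c * fib k + c * fib k      ≡⟨ solve 2 (λ c F → c :* F :+ c :* F := F :* (con 2 :* c)) refl c (fib k) ⟩
    fib k * (2 * c)            ∎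
    where
    c≤cF : c ≤ c * fib k
    c≤cF = ≤-trans (≤-reflexive (sym (*-identityʳ c))) (*-monoʳ-≤ c 0<F)

appended-fib-bound-near : ∀ {c d p i q} → lucas (suc p) ≢ c → d < c → suc p + i ≡ 3 + q →
  fib (suc (3 + q + p)) ≡ c * fib (3 + q) + d → fib (3 + q) < 3 * c
appended-fib-bound-near {c} {d} {p} {i} {q} L≢c d<c k≡ fib≡ = begin-strict
  fib (3 + q)          ≤⟨ fib[3+n]≤3*fib[1+n] q ⟩
  3 * fib (suc q)      <⟨ *-monoʳ-< 3 (≤-<-trans fib[1+q]≤d d<c) ⟩
  3 * c                ∎
  where
  open ≤-Reasoning
  fib-i≤fib[2+q] : fib i ≤ fib (2 + q)
  fib-i≤fib[2+q] = fib-mono-≤ (≤-pred (subst (i <_) k≡ (m<n+m i (s≤s z≤n))))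
  near : lucas (suc p) * fib (3 + q) ≡ c * fib (3 + q) + d ± fib i
  near = subst₂ (λ k m → lucas (suc p) * fib k ≡ m ± fib i) k≡
           (trans (cong (λ k → fib (suc (k + p))) k≡) fib≡) (lucas-*-fib p i)
  fib[3+q]≤fib[2+q]+d : fib (2 + q) + fib (suc q) ≤ fib (2 + q) + d
  fib[3+q]≤fib[2+q]+d = begin
    fib (3 + q)        ≤⟨ near-multiple-bound L≢c (≤-<-trans fib-i≤fib[2+q] (m<m+n (fib (2 + q)) (fib-suc-pos q))) near ⟩
    d + fib i          ≤⟨ +-monoʳ-≤ d fib-i≤fib[2+q] ⟩
    d + fib (2 + q)    ≡⟨ +-comm d (fib (2 + q)) ⟩
    fib (2 + q) + d    ∎
  fib[1+q]≤d : fib (suc q) ≤ d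
  fib[1+q]≤d = +-cancelˡ-≤ (fib (2 + q)) (fib (suc q)) d fib[3+q]≤fib[2+q]+d

lucas≢⇒2≤ : ∀ {c} → 0 < c → (∀ p → lucas p ≢ c) → 2 ≤ c
lucas≢⇒2≤ {suc zero}    _ not-lucas = contradiction refl (not-lucas 1)
lucas≢⇒2≤ {suc (suc _)} _ _         = s≤s (s≤s z≤n)

appended-fib-bound : ∀ {c d k m} → (∀ p → lucas p ≢ c) → d < c →
  fib m ≡ c * fib k + d → fib k < 3 * c
appended-fib-bound {c} {k = 0}     _ d<c _ = <-≤-trans (≤-<-trans z≤n d<c) (m≤n*m c 3)
appended-fib-bound {c} {k = 1}     _ d<c _ = ≤-trans (s≤s (s≤s z≤n)) (*-monoʳ-≤ 3 (≤-<-trans z≤n d<c))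
appended-fib-bound {c} {k = 2}     _ d<c _ = ≤-trans (s≤s (s≤s z≤n)) (*-monoʳ-≤ 3 (≤-<-trans z≤n d<c))
appended-fib-bound {c} {d} {k@(suc (suc (suc q)))} {m} not-lucas d<c fib-m≡ =
  bound (m ∸ suc k) (subst (λ j → fib j ≡ c * fib k + d) (sym (m+[n∸m]≡n k<m)) fib-m≡)
  where
  k<m : k < m
  k<m = fib-index-< (lucas≢⇒2≤ (≤-<-trans z≤n d<c) not-lucas) (fib-suc-pos (2 + q)) fib-m≡
  bound : ∀ p → fib (suc (k + p)) ≡ c * fib k + d → fib k < 3 * c
  bound p fib≡ with k ≤? p
  ... | yes k≤p = <-≤-trans (appended-fib-bound-far (fib-suc-pos (2 + q)) k≤p d<c fib≡) (m≤n*m c 3)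
  ... | no  k≰p = appended-fib-bound-near (not-lucas (suc p)) d<c (m+[n∸m]≡n (≰⇒> k≰p)) fib≡

appended-fib-digits : ∀ {e n d k m} → 1 ≤ n → d < 10 ^ n → fib m ≡ 10 ^ n * fib k + d →
  10 ^ e ≤ fib k → e ≤ n
appended-fib-digits {n = n} {k = k} {m = m} 1≤n d<10^n fib≡ 10^e≤F = ≮⇒≥ λ n<e →
  <⇒≱ F<10^[1+n] (≤-trans (^-monoʳ-≤ 10 n<e) 10^e≤F)
  where
  F<10^[1+n] : fib k < 10 ^ suc n
  F<10^[1+n] = <-≤-trans (appended-fib-bound {k = k} {m} (lucas≢10^ {n} 1≤n) d<10^n fib≡)
                         (*-monoˡ-≤ (10 ^ n) (≤ᵇ⇒≤ 3 10 _))

appendStep-digits : ∀ {N e a b} → PosFib a → PosFib b → (st : AppendStep N a b) →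
  10 ^ e ≤ a → e ≤ proj₁ st × 10 ^ (e + proj₁ st) ≤ b
appendStep-digits {e = e} (_ , k , refl) (_ , m , refl) (n , d , 1≤n , _ , d<10^n , fib≡) 10^e≤a =
  appended-fib-digits {k = k} {m} 1≤n d<10^n fib≡ 10^e≤a , (begin
    10 ^ (e + n)         ≡⟨ ^-distribˡ-+-* 10 e n ⟩
    10 ^ e * 10 ^ n      ≡⟨ *-comm (10 ^ e) (10 ^ n) ⟩
    10 ^ n * 10 ^ e      ≤⟨ *-monoʳ-≤ (10 ^ n) 10^e≤a ⟩
    10 ^ n * fib k       ≤⟨ m≤m+n (10 ^ n * fib k) d ⟩
    10 ^ n * fib k + d   ≡⟨ fib≡ ⟨
    fib m                ∎)
  where open ≤-Reasoning

fibWalk-digits : ∀ {N e a b} bs → 10 ^ e ≤ a → FibWalk N (a ∷ b ∷ bs) → 2 ^ length bs * e ≤ N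
fibWalk-digits {e = e} [] 10^e≤a (pa ∷ pb ∷ [] , st@(_ , _ , _ , n≤N , _) ∷ [-]) = begin
  e + 0   ≡⟨ +-identityʳ e ⟩
  e       ≤⟨ proj₁ (appendStep-digits pa pb st 10^e≤a) ⟩
  _       ≤⟨ n≤N ⟩
  _       ∎
  where open ≤-Reasoning
fibWalk-digits {N} {e} (_ ∷ cs) 10^e≤a (pa ∷ pb ∷ ps , st ∷ sts) =
  let e≤n , 10^[e+n]≤b = appendStep-digits pa pb st 10^e≤a
      10^[e+e]≤b       = ≤-trans (^-monoʳ-≤ 10 (+-monoʳ-≤ e e≤n)) 10^[e+n]≤b
  in subst (_≤ N) (solve 2 (λ x e → x :* (e :+ e) := (con 2 :* x) :* e) refl (2 ^ length cs) e)
       (fibWalk-digits cs 10^[e+e]≤b (pb ∷ ps , sts))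

no-fib-between : ∀ t m → fib t < fib m → fib m < fib (suc t) → ⊥
no-fib-between t m fib-t<fib-m fib-m<fib[1+t] with m ≤? t
... | yes m≤t = <⇒≱ fib-t<fib-m (fib-mono-≤ m≤t)
... | no  m≰t = <⇒≱ fib-m<fib[1+t] (fib-mono-≤ (≰⇒> m≰t))

gap-append≢fib : ∀ t k n {d} → T (fib t <ᵇ 10 ^ n * fib k) →
  T (10 ^ n * fib k + 10 ^ n ≤ᵇ fib (suc t)) → d < 10 ^ n → ∀ m → fib m ≢ 10 ^ n * fib k + d
gap-append≢fib t k n {d} below above d<10^n m fib≡ = no-fib-between t m
  (<-≤-trans (<ᵇ⇒< _ _ below) (≤-trans (m≤m+n _ d) (≤-reflexive (sym fib≡))))
  (<-≤-trans (≤-<-trans (≤-reflexive fib≡) (+-monoʳ-< _ d<10^n)) (≤ᵇ⇒≤ _ _ above))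

-- After one or two appended digits, 13, 21, 34, 55, 89 land strictly between F_t and F_(t+1);
-- ≤⇒≤ᵇ turns a false inequality between closed terms into T false, i.e. ⊥.
two-digit-fib-append≢fib : ∀ {k n d} → 10 ≤ fib k → fib k < 100 → 1 ≤ n → n ≤ 2 →
  d < 10 ^ n → ∀ m → fib m ≢ 10 ^ n * fib k + d
two-digit-fib-append≢fib {7}  {1} _ _ _ _ = gap-append≢fib 11 7  1 tt tt
two-digit-fib-append≢fib {7}  {2} _ _ _ _ = gap-append≢fib 16 7  2 tt tt
two-digit-fib-append≢fib {8}  {1} _ _ _ _ = gap-append≢fib 12 8  1 tt tt
two-digit-fib-append≢fib {8}  {2} _ _ _ _ = gap-append≢fib 17 8  2 tt tt
two-digit-fib-append≢fib {9}  {1} _ _ _ _ = gap-append≢fib 13 9  1 tt tt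
two-digit-fib-append≢fib {9}  {2} _ _ _ _ = gap-append≢fib 18 9  2 tt tt
two-digit-fib-append≢fib {10} {1} _ _ _ _ = gap-append≢fib 14 10 1 tt tt
two-digit-fib-append≢fib {10} {2} _ _ _ _ = gap-append≢fib 19 10 2 tt tt
two-digit-fib-append≢fib {11} {1} _ _ _ _ = gap-append≢fib 15 11 1 tt tt
two-digit-fib-append≢fib {11} {2} _ _ _ _ = gap-append≢fib 20 11 2 tt tt
two-digit-fib-append≢fib {n = 0} _ _ () _
two-digit-fib-append≢fib {n = suc (suc (suc _))} _ _ _ (s≤s (s≤s ()))
two-digit-fib-append≢fib {0} 10≤F = ⊥-elim (≤⇒≤ᵇ 10≤F)
two-digit-fib-append≢fib {1} 10≤F = ⊥-elim (≤⇒≤ᵇ 10≤F)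
two-digit-fib-append≢fib {2} 10≤F = ⊥-elim (≤⇒≤ᵇ 10≤F)
two-digit-fib-append≢fib {3} 10≤F = ⊥-elim (≤⇒≤ᵇ 10≤F)
two-digit-fib-append≢fib {4} 10≤F = ⊥-elim (≤⇒≤ᵇ 10≤F)
two-digit-fib-append≢fib {5} 10≤F = ⊥-elim (≤⇒≤ᵇ 10≤F)
two-digit-fib-append≢fib {6} 10≤F = ⊥-elim (≤⇒≤ᵇ 10≤F)
two-digit-fib-append≢fib {suc (suc (suc (suc (suc (suc (suc (suc (suc (suc (suc (suc k)))))))))))} _ F<100 =
  ⊥-elim (≤⇒≤ᵇ (≤-trans (s≤s (fib-mono-≤ {12} (m≤m+n 12 k))) F<100))

two-digit-appendStep : ∀ {N a b} → PosFib a → PosFib b → 10 ≤ a → a < 100 →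
  (st : AppendStep N a b) → 3 ≤ proj₁ st
two-digit-appendStep (_ , k , refl) (_ , m , refl) 10≤a a<100 (n , d , 1≤n , _ , d<10^n , fib≡)
  with n ≤? 2
... | yes n≤2 = ⊥-elim (two-digit-fib-append≢fib {k} 10≤a a<100 1≤n n≤2 d<10^n m fib≡)
... | no  n≰2 = ≰⇒> n≰2

two-digit-fibWalk : ∀ {N b c} cs → 10 ≤ b → b < 100 → FibWalk N (b ∷ c ∷ cs) → 2 ^ length (c ∷ cs) ≤ N
two-digit-fibWalk [] 10≤b b<100 (pb ∷ pc ∷ [] , st@(_ , _ , _ , n≤N , _) ∷ [-]) =
  ≤-trans (≤-trans (s≤s (s≤s z≤n)) (two-digit-appendStep pb pc 10≤b b<100 st)) n≤N
two-digit-fibWalk {N} (_ ∷ cs) 10≤b b<100 (pb ∷ pc ∷ ps , st ∷ sts) =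
  let 3≤n            = two-digit-appendStep pb pc 10≤b b<100 st
      _ , 10^[1+n]≤c = appendStep-digits {e = 1} pb pc st 10≤b
  in subst (_≤ N) (solve 1 (λ x → x :* con 4 := con 2 :* (con 2 :* x)) refl (2 ^ length cs))
       (fibWalk-digits cs (≤-trans (^-monoʳ-≤ 10 (s≤s 3≤n)) 10^[1+n]≤c) (pc ∷ ps , sts))

one-digit-fibWalk : ∀ {N a b} bs → a < 10 → FibWalk N (a ∷ b ∷ bs) → 2 ^ length bs ≤ N
one-digit-fibWalk [] _ (_ , (_ , _ , 1≤n , n≤N , _) ∷ [-]) = ≤-trans 1≤n n≤N
one-digit-fibWalk {N} (_ ∷ cs) _ (pa ∷ pb ∷ ps , st@(suc (suc n) , _) ∷ sts) =
  let _ , 10^n≤b = appendStep-digits {e = 0} pa pb st (proj₁ pa)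
  in subst (_≤ N) (*-comm (2 ^ length cs) 2)
       (fibWalk-digits cs (≤-trans (^-monoʳ-≤ 10 {2} {2 + n} (s≤s (s≤s z≤n))) 10^n≤b) (pb ∷ ps , sts))
one-digit-fibWalk (_ ∷ cs) a<10 (pa ∷ pb ∷ ps , st@(1 , d , _ , _ , d<10 , refl) ∷ sts) =
  let _ , 10≤b = appendStep-digits {e = 0} pa pb st (proj₁ pa)
  in two-digit-fibWalk cs 10≤b (+-mono-≤-< (*-monoʳ-≤ 10 (≤-pred a<10)) d<10) (pb ∷ ps , sts)
one-digit-fibWalk (_ ∷ _) _ (_ , (0 , _ , () , _) ∷ _)

2^≤⇒≤⌊log₂⌋ : ∀ {x n} → 2 ^ x ≤ n → x ≤ ⌊log₂ n ⌋
2^≤⇒≤⌊log₂⌋ {x} {n} 2^x≤n = subst (_≤ ⌊log₂ n ⌋) (⌊log₂[2^n]⌋≡n x) (⌊log₂⌋-mono-≤ 2^x≤n)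

2^*≤⇒≤floorLog2Frac : ∀ {x p q} → 1 ≤ q → 2 ^ x * q ≤ p → + x ≤ℤ floorLog2Frac p q
2^*≤⇒≤floorLog2Frac {x} {zero} {suc q} _ 2^x*q≤0 =
  ⊥-elim (<⇒≱ (*-mono-≤ (m^n>0 2 x) (s≤s z≤n)) 2^x*q≤0)
2^*≤⇒≤floorLog2Frac {x} {suc p} {suc q} _ 2^x*q≤p
  with suc q ≤ᵇ suc p | ≤⇒≤ᵇ (≤-trans (m≤n*m (suc q) (2 ^ x) ⦃ m^n≢0 2 x ⦄) 2^x*q≤p)
... | true | _ = +≤+ (2^≤⇒≤⌊log₂⌋ (begin
  2 ^ x                   ≡⟨ m*n/n≡m (2 ^ x) (suc q) ⟨
  2 ^ x * suc q / suc q   ≤⟨ /-monoˡ-≤ (suc q) 2^x*q≤p ⟩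
  suc p / suc q           ∎))
  where open ≤-Reasoning

theorem1p3 : (N : ℕ) → 1 ≤ N →
    (a : ℕ) (as : List ℕ) → FibWalk N (a ∷ as) →
    (N₀ : ℕ) → 1 ≤ N₀ → 10 ^ (N₀ ∸ 1) ≤ a → a < 10 ^ N₀ →
    ((2 ≤ N₀ → 1 ≤ length as →
        + length (a ∷ as) ≤ℤ floorLog2Frac N (N₀ ∸ 1) +ℤ + 2)
     × (N₀ ≡ 1 → length (a ∷ as) ≤ ⌊log₂ N ⌋ + 2))
theorem1p3 N _ a as walk N₀ _ 10^[N₀-1]≤a a<10^N₀ = many-digits as walk , one-digit as walk
  where
  many-digits : ∀ bs → FibWalk N (a ∷ bs) → 2 ≤ N₀ → 1 ≤ length bs →
    + length (a ∷ bs) ≤ℤ floorLog2Frac N (N₀ ∸ 1) +ℤ + 2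
  many-digits []       _    _    ()
  many-digits (_ ∷ bs) walk 2≤N₀ _ = subst (λ ℓ → + ℓ ≤ℤ floorLog2Frac N (N₀ ∸ 1) +ℤ + 2)
    (+-comm (length bs) 2)
    (+ℤ-monoˡ-≤ (+ 2) (2^*≤⇒≤floorLog2Frac (∸-monoˡ-≤ 1 2≤N₀) (fibWalk-digits bs 10^[N₀-1]≤a walk)))
  one-digit : ∀ bs → FibWalk N (a ∷ bs) → N₀ ≡ 1 → length (a ∷ bs) ≤ ⌊log₂ N ⌋ + 2
  one-digit []       _    _    = ≤-trans (s≤s z≤n) (m≤n+m 2 ⌊log₂ N ⌋)
  one-digit (_ ∷ bs) walk refl = subst (_≤ ⌊log₂ N ⌋ + 2) (+-comm (length bs) 2)
    (+-monoˡ-≤ 2 (2^≤⇒≤⌊log₂⌋ (one-digit-fibWalk bs a<10^N₀ walk)))
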